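{- Let $F$ be a CNF with $n$ variables whose incidence graph has pathwidth $p$. Then $F$ can be compiled into an OBDD of size $O(2^p n)$.
   Context: The incidence graph of a CNF has a vertex for each variable and a vertex for each clause, a variable vertex being adjacent to a clause vertex iff the variable occurs in the clause. Pathwidth is the minimum width (maximum bag size minus one) of a path decomposition. An OBDD is an ordered binary decision diagram: a rooted DAG with two sinks labelled $true$ and $false$, internal nodes labelled by variables with two outgoing edges labelled $true$/$false$, variables along each root-to-sink path respecting a fixed linear order, computing the function whose satisfying assignments are those read along root-to-$true$ paths; its size is its number of nodes. -}

module Defs where

open import Data.Nat using (ℕ; zero; suc; _+_; _*_; _∸_; _^_; _≤_; _<_; _⊔_)
open import Data.Bool using (Bool; true; false; not)
open import Data.Fin using (Fin; _↑ˡ_; _↑ʳ_) renaming (_≤_ to _≤ᶠ_)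
open import Data.Fin.Subset using (Subset; _∈_; ∣_∣)
open import Data.List using (List; length; lookup; foldr; tabulate)
open import Data.Bool.ListAction using (all; any)
import Data.List.Membership.Propositional as LM
open import Data.Product using (Σ; ∃; ∃-syntax; _×_; _,_)
open import Data.Sum using (_⊎_; inj₁; inj₂)
open import Relation.Binary.PropositionalEquality using (_≡_)
open import Function.Definitions using (Injective)

Literal : ℕ → Set
Literal n = Fin n × Bool

Clause : ℕ → Set
Clause n = List (Literal n)

CNF : ℕ → Set
CNF n = List (Clause n)

Assignment : ℕ → Set
Assignment n = Fin n → Bool

evalLit : ∀ {n} → Assignment n → Literal n → Bool
evalLit a (x , true)  = a x
evalLit a (x , false) = not (a x)

evalClause : ∀ {n} → Assignment n → Clause n → Bool
evalClause a C = any (evalLit a) C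

evalCNF : ∀ {n} → Assignment n → CNF n → Bool
evalCNF a F = all (evalClause a) F

OccursIn : ∀ {n} → Fin n → Clause n → Set
OccursIn x C = ∃[ pol ] (LM._∈_ (x , pol) C)

record Graph : Set₁ where
  field
    N   : ℕ
    Adj : Fin N → Fin N → Set

-- Incidence graph: vertices Fin (n + m); x ↑ˡ m is variable x,
-- n ↑ʳ j is the j-th clause (m = number of clauses).
data IncEdge {n : ℕ} (F : CNF n) : Fin (n + length F) → Fin (n + length F) → Set where
  var-clause : (x : Fin n) (j : Fin (length F)) → OccursIn x (lookup F j) →
               IncEdge F (x ↑ˡ length F) (n ↑ʳ j)
  clause-var : (x : Fin n) (j : Fin (length F)) → OccursIn x (lookup F j) →
               IncEdge F (n ↑ʳ j) (x ↑ˡ length F)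

incidenceGraph : ∀ {n} → CNF n → Graph
incidenceGraph {n} F = record { N = n + length F ; Adj = IncEdge F }

record PathDecomposition (G : Graph) : Set where
  open Graph G
  field
    L   : ℕ
    bag : Fin L → Subset N
    covers-vertices : ∀ v → ∃[ i ] (v ∈ bag i)
    covers-edges    : ∀ u v → Adj u v → ∃[ i ] (u ∈ bag i × v ∈ bag i)
    contiguous      : ∀ v (i j k : Fin L) → i ≤ᶠ j → j ≤ᶠ k →
                      v ∈ bag i → v ∈ bag k → v ∈ bag j

width : ∀ {G} → PathDecomposition G → ℕ
width d = foldr _⊔_ 0 (tabulate (λ i → ∣ PathDecomposition.bag d i ∣)) ∸ 1

IsPathwidth : Graph → ℕ → Set
IsPathwidth G p = (∃[ d ] (width {G} d ≡ p)) × (∀ (d : PathDecomposition G) → p ≤ width d)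

-- Nodes: inj₁ u for the k internal nodes, inj₂ b for the sink labelled b.
record OBDD (n : ℕ) : Set where
  field
    k     : ℕ
    rank  : Fin n → ℕ                   -- the fixed linear order on variables
    rank-injective : Injective _≡_ _≡_ rank
    root  : Fin k ⊎ Bool
    var   : Fin k → Fin n
    child : Fin k → Bool → Fin k ⊎ Bool
    -- variables strictly increase in the order along every edge (hence a DAG,
    -- and every root-to-sink path respects the order)
    ordered : ∀ u b v → child u b ≡ inj₁ v → rank (var u) < rank (var v)

  Node : Set
  Node = Fin k ⊎ Bool

-- number of nodes (internal nodes plus the two sinks)
size : ∀ {n} → OBDD n → ℕ
size B = OBDD.k B + 2

data Reaches {n} (B : OBDD n) (a : Assignment n) : Fin (OBDD.k B) ⊎ Bool → Bool → Set where
  sink : ∀ r → Reaches B a (inj₂ r) r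
  step : ∀ u r → Reaches B a (OBDD.child B u (a (OBDD.var B u))) r →
         Reaches B a (inj₁ u) r

Computes : ∀ {n} → OBDD n → CNF n → Set
Computes B F = ∀ a → Reaches B a (OBDD.root B) (evalCNF a F)

module Submission where

-- Fix a path decomposition of the incidence graph of width p.  Every vertex v
-- has a first bag `first v` containing it; ordering vertices by (first v, v)
-- gives an injective rank, and the OBDD reads the variables in increasing rank.
-- When variable x is about to be read, the relevant history of the partial
-- assignment is a Boolean for each vertex of the bag `home x` (the first bag
-- of x): for a variable, its value if already read; for a clause that is still
-- open, whether some already read literal satisfies it.  The bag has at most
-- p+1 vertices, so this state fits into Fin (2^(p+1)), and the OBDD has a node
-- for every pair (x, state): n · 2^(p+1) internal nodes.  Reading x completes
-- the clauses whose last variable is x; if one of them is unsatisfied the path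
-- goes to the false sink, and after the last variable to the true sink.

open import Defs
open import Data.Nat using (ℕ; zero; suc; _+_; _*_; _^_; _≤_; _<_; _⊔_; s≤s)
open import Data.Nat.Properties
open import Data.Bool using (Bool; true; false; _∧_; _∨_; not; if_then_else_)
open import Data.Bool.Properties using (∨-identityʳ; ∨-commutativeMonoid)
open import Data.Bool.ListAction using (all; any)
open import Data.Fin using (Fin; zero; suc; toℕ; combine; remQuot; quotient; remainder; fromℕ<; splitAt; _↑ˡ_; _↑ʳ_)
open import Data.Fin.Properties using (combine-injectiveʳ; combine-monoˡ-<; remQuot-combine; ↑ˡ-injective; splitAt-↑ˡ; splitAt-↑ʳ; toℕ<n; toℕ-injective) renaming (_≟_ to _≟ᶠ_)
open import Data.Fin.Subset using (Subset; ∣_∣) renaming (_∈_ to _∈ₛ_; _∉_ to _∉ₛ_)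
open import Data.Fin.Subset.Properties using (_∈?_)
open import Data.Vec using ([]; _∷_; here; there)
open import Data.List using (List; []; _∷_; length; lookup; foldr; tabulate; allFin; null)
open import Data.List.Membership.Propositional using (_∈_)
open import Data.List.Membership.Propositional.Properties using (∈-allFin; ∈-lookup)
open import Data.List.Relation.Unary.Any using (here; there)
open import Data.Product using (∃-syntax; _×_; _,_; proj₁; proj₂)
open import Data.Sum using (_⊎_; inj₁; inj₂; [_,_]′)
open import Data.Unit using (⊤; tt)
open import Relation.Nullary using (Dec; yes; no; ¬_; does; contradiction)
open import Relation.Nullary.Decidable using (dec-true; dec-false; does-⇔)
open import Relation.Binary.PropositionalEquality using (_≡_; _≢_; refl; sym; trans; cong; cong₂; subst; module ≡-Reasoning)
open import Function using (_∘_)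
open import Function.Bundles using (mk⇔)
open import Algebra.Bundles using (CommutativeMonoid)
open import Algebra.Properties.CommutativeSemigroup
  (CommutativeMonoid.commutativeSemigroup ∨-commutativeMonoid) using (interchange)
open import Data.Nat.Solver using (module +-*-Solver)

does-true : ∀ {A : Set} (d : Dec A) → does d ≡ true → A
does-true (yes a) _ = a

∧-true : ∀ {a b} → a ∧ b ≡ true → a ≡ true × b ≡ true
∧-true {true} {true} _ = refl , refl

not-true : ∀ {b} → not b ≡ true → b ≡ false
not-true {false} _ = refl

not-false : ∀ {b} → not b ≡ false → b ≡ true
not-false {true} _ = refl

module _ {A : Set} where

  any-cong : (f g : A → Bool) (xs : List A) →
             (∀ l → l ∈ xs → f l ≡ g l) → any f xs ≡ any g xs
  any-cong f g []       e = refl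
  any-cong f g (x ∷ xs) e = cong₂ _∨_ (e x (here refl)) (any-cong f g xs (λ l m → e l (there m)))

  any-∨ : (f g : A → Bool) (xs : List A) →
          (any f xs ∨ any g xs) ≡ any (λ l → f l ∨ g l) xs
  any-∨ f g []       = refl
  any-∨ f g (x ∷ xs) =
    trans (interchange (f x) (any f xs) (g x) (any g xs)) (cong ((f x ∨ g x) ∨_) (any-∨ f g xs))

  any-true⇒ : (f : A → Bool) (xs : List A) → any f xs ≡ true → ∃[ l ] (l ∈ xs × f l ≡ true)
  any-true⇒ f (x ∷ xs) e with f x in fx
  ... | true  = x , here refl , fx
  ... | false = let (l , m , q) = any-true⇒ f xs e in l , there m , q

  any-false⇒ : (f : A → Bool) (xs : List A) → any f xs ≡ false → ∀ l → l ∈ xs → f l ≡ false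
  any-false⇒ f (x ∷ xs) e l m with f x in fx | m
  ... | false | here refl = fx
  ... | false | there m′  = any-false⇒ f xs e l m′

  any-false⇐ : (f : A → Bool) (xs : List A) → (∀ l → l ∈ xs → f l ≡ false) → any f xs ≡ false
  any-false⇐ f []       e = refl
  any-false⇐ f (x ∷ xs) e rewrite e x (here refl) = any-false⇐ f xs (λ l m → e l (there m))

  all-true⇒ : (f : A → Bool) (xs : List A) → all f xs ≡ true → ∀ l → l ∈ xs → f l ≡ true
  all-true⇒ f (x ∷ xs) e l m with f x in fx | m
  ... | true | here refl = fx
  ... | true | there m′  = all-true⇒ f xs e l m′

  all-true⇐ : (f : A → Bool) (xs : List A) → (∀ l → l ∈ xs → f l ≡ true) → all f xs ≡ true
  all-true⇐ f []       e = refl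
  all-true⇐ f (x ∷ xs) e rewrite e x (here refl) = all-true⇐ f xs (λ l m → e l (there m))

  all-false⇐ : (f : A → Bool) (xs : List A) (l : A) → l ∈ xs → f l ≡ false → all f xs ≡ false
  all-false⇐ f (x ∷ xs) l (here refl) e rewrite e = refl
  all-false⇐ f (x ∷ xs) l (there m)   e with f x
  ... | true  = all-false⇐ f xs l m e
  ... | false = refl

  all-lookup⇐ : (f : A → Bool) (xs : List A) → (∀ j → f (lookup xs j) ≡ true) → all f xs ≡ true
  all-lookup⇐ f []       e = refl
  all-lookup⇐ f (x ∷ xs) e rewrite e zero = all-lookup⇐ f xs (e ∘ suc)

data Least {k : ℕ} (h : Fin k → ℕ) (P : Fin k → Set) : Set where
  found : (y : Fin k) → P y → (∀ z → P z → h y ≤ h z) → Least h P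
  none  : (∀ z → ¬ P z) → Least h P

least : ∀ {k} (h : Fin k → ℕ) (P : Fin k → Set) → (∀ i → Dec (P i)) → Least h P
least {zero}  h P P? = none (λ ())
least {suc k} h P P? with least (h ∘ suc) (P ∘ suc) (P? ∘ suc) | P? zero
... | none ¬p       | no ¬p₀ = none λ { zero → ¬p₀ ; (suc z) → ¬p z }
... | none ¬p       | yes p₀ = found zero p₀ λ { zero _ → ≤-refl ; (suc z) pz → contradiction pz (¬p z) }
... | found y py my | no ¬p₀ = found (suc y) py λ { zero pz → contradiction pz ¬p₀ ; (suc z) pz → my z pz }
... | found y py my | yes p₀ with h zero ≤? h (suc y)
...   | yes h₀≤ = found zero p₀ λ { zero _ → ≤-refl ; (suc z) pz → ≤-trans h₀≤ (my z pz) }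
...   | no  h₀≰ = found (suc y) py λ { zero _ → <⇒≤ (≰⇒> h₀≰) ; (suc z) pz → my z pz }

≤-maximum : ∀ {L} (f : Fin L → ℕ) i → f i ≤ foldr _⊔_ 0 (tabulate f)
≤-maximum f zero    = m≤m⊔n _ _
≤-maximum f (suc i) = ≤-trans (≤-maximum (f ∘ suc) i) (m≤n⊔m _ _)

-- The values of g : Fin N → Bool on a subset S with ∣ S ∣ ≤ q are packed into
-- a number below 2 ^ q, one binary digit per element of S.

bit : Bool → Fin 2
bit false = zero
bit true  = suc zero

unbit : Fin 2 → Bool
unbit zero       = false
unbit (suc zero) = true

unbit-bit : ∀ b → unbit (bit b) ≡ b
unbit-bit false = refl
unbit-bit true  = refl

encode : ∀ {N} (S : Subset N) {q} → ∣ S ∣ ≤ q → (Fin N → Bool) → Fin (2 ^ q)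
encode []          {q}     _       g = fromℕ< (m^n>0 2 q)
encode (true  ∷ S) {suc q} (s≤s h) g = combine (bit (g zero)) (encode S h (g ∘ suc))
encode (false ∷ S)         h       g = encode S h (g ∘ suc)

decode : ∀ {N} (S : Subset N) {q} → ∣ S ∣ ≤ q → Fin (2 ^ q) → Fin N → Bool
decode (true  ∷ S) {suc q} (s≤s h) σ zero    = unbit (quotient (2 ^ q) σ)
decode (true  ∷ S) {suc q} (s≤s h) σ (suc v) = decode S h (remainder {2} (2 ^ q) σ) v
decode (false ∷ S)         h       σ zero    = false
decode (false ∷ S)         h       σ (suc v) = decode S h σ v

decode-encode : ∀ {N} (S : Subset N) {q} (h : ∣ S ∣ ≤ q) g v → v ∈ₛ S →
                decode S h (encode S h g) v ≡ g v
decode-encode (true  ∷ S) {suc q} (s≤s h) g zero here =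
  trans (cong (unbit ∘ proj₁) (remQuot-combine (bit (g zero)) (encode S h (g ∘ suc)))) (unbit-bit (g zero))
decode-encode (true  ∷ S) {suc q} (s≤s h) g (suc v) (there v∈S) =
  trans (cong (λ r → decode S h (proj₂ r) v) (remQuot-combine (bit (g zero)) (encode S h (g ∘ suc))))
        (decode-encode S h (g ∘ suc) v v∈S)
decode-encode (false ∷ S) h g (suc v) (there v∈S) = decode-encode S h (g ∘ suc) v v∈S

module _ {G : Graph} (d : PathDecomposition G) where
  open PathDecomposition d

  bag-size : ∀ {p} → width d ≡ p → ∀ i → ∣ bag i ∣ ≤ suc p
  bag-size refl i = ≤-trans (≤-maximum (λ i → ∣ bag i ∣) i) (m≤n+m∸n _ 1)

-- The elimination order of a path decomposition: vertices sorted by the first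
-- bag containing them, ties broken by the vertex index.
module EliminationOrder {G : Graph} (d : PathDecomposition G) where
  open Graph G
  open PathDecomposition d

  firstBag : ∀ v → ∃[ i ] (v ∈ₛ bag i × (∀ t → v ∈ₛ bag t → toℕ i ≤ toℕ t))
  firstBag v with least toℕ (λ i → v ∈ₛ bag i) (λ i → v ∈? bag i)
  ... | found i v∈i min = i , v∈i , min
  ... | none ¬v∈        = let (i , v∈i) = covers-vertices v in contradiction v∈i (¬v∈ i)

  first : Fin N → Fin L
  first v = proj₁ (firstBag v)

  first-∈ : ∀ v → v ∈ₛ bag (first v)
  first-∈ v = proj₁ (proj₂ (firstBag v))

  first-min : ∀ v t → v ∈ₛ bag t → toℕ (first v) ≤ toℕ t
  first-min v = proj₂ (proj₂ (firstBag v))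

  order : Fin N → ℕ
  order v = toℕ (combine (first v) v)

  order-injective : ∀ {u v} → order u ≡ order v → u ≡ v
  order-injective {u} {v} eq = combine-injectiveʳ (first u) u (first v) v (toℕ-injective eq)

  order<bound : ∀ v → order v < L * N
  order<bound v = toℕ<n (combine (first v) v)

  order-≤⇒first-≤ : ∀ {u v} → order u ≤ order v → toℕ (first u) ≤ toℕ (first v)
  order-≤⇒first-≤ {u} {v} le = ≮⇒≥ (λ lt → <⇒≱ (combine-monoˡ-< v u lt) le)

  -- Once v has been introduced, an earlier vertex u occurring in a bag at or
  -- after first v already occurs in first v (bags containing u are contiguous).
  earlier-in-first-bag : ∀ {u v} t → order u < order v → toℕ (first v) ≤ toℕ t →
                         u ∈ₛ bag t → u ∈ₛ bag (first v)
  earlier-in-first-bag {u} {v} t u<v v≤t u∈t =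
    contiguous u (first u) (first v) t (order-≤⇒first-≤ (<⇒≤ u<v)) v≤t (first-∈ u) u∈t

  -- If c is absent from first v but has a neighbour z introduced no earlier
  -- than v, then every neighbour u of c introduced before v is in first v:
  -- the edge u–c can only be covered after first v.
  separated-neighbour : ∀ {u v z c} → Adj z c → Adj u c → order v ≤ order z →
                        c ∉ₛ bag (first v) → order u < order v → u ∈ₛ bag (first v)
  separated-neighbour {u} {v} {z} {c} zc uc v≤z c∉ u<v
    with covers-edges z c zc | covers-edges u c uc
  ... | b , z∈b , c∈b | a , u∈a , c∈a with toℕ a ≤? toℕ (first v)
  ...   | yes a≤ = contradiction
                     (contiguous c a (first v) b a≤ (≤-trans (order-≤⇒first-≤ v≤z) (first-min z b z∈b)) c∈a c∈b) c∉
  ...   | no  a≰ = earlier-in-first-bag a u<v (<⇒≤ (≰⇒> a≰)) u∈a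

module _ {n : ℕ} where

  satBy : (Fin n → Bool) → Assignment n → Clause n → Bool
  satBy R a C = any (λ l → R (proj₁ l) ∧ evalLit a l) C

  evalLit-cong : ∀ (h a : Assignment n) {y} pol → h y ≡ a y → evalLit h (y , pol) ≡ evalLit a (y , pol)
  evalLit-cong h a true  e = e
  evalLit-cong h a false e = cong not e

  satBy-cong : ∀ R (h a : Assignment n) C →
               (∀ y pol → (y , pol) ∈ C → R y ≡ true → h y ≡ a y) → satBy R h C ≡ satBy R a C
  satBy-cong R h a C agree = any-cong _ _ C λ { (y , pol) l∈C → literal y pol l∈C }
    where
      literal : ∀ y pol → (y , pol) ∈ C → (R y ∧ evalLit h (y , pol)) ≡ (R y ∧ evalLit a (y , pol))
      literal y pol l∈C with R y in Ry
      ... | true  = evalLit-cong h a pol (agree y pol l∈C Ry)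
      ... | false = refl

  satBy-reads-cong : ∀ {R R′} a C → (∀ y → R y ≡ R′ y) → satBy R a C ≡ satBy R′ a C
  satBy-reads-cong a C R≗R′ = any-cong _ _ C (λ l _ → cong (_∧ evalLit a l) (R≗R′ (proj₁ l)))

  satBy-all : ∀ R a C → all (R ∘ proj₁) C ≡ true → satBy R a C ≡ evalClause a C
  satBy-all R a C all-R = any-cong _ _ C (λ l l∈C → cong (_∧ evalLit a l) (all-true⇒ _ C all-R l l∈C))

  satBy-none : ∀ R a C → (∀ y → R y ≡ false) → satBy R a C ≡ false
  satBy-none R a C R-false = any-false⇐ _ C (λ l _ → cong (_∧ evalLit a l) (R-false (proj₁ l)))

  null-false⇒literal : ∀ (C : Clause n) → null C ≡ false → ∃[ l ] (l ∈ C)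
  null-false⇒literal (l ∷ _) _ = l , here refl

  null-unsat : ∀ (a : Assignment n) (C : Clause n) → null C ≡ true → evalClause a C ≡ false
  null-unsat a [] _ = refl

module Compile {n : ℕ} (F : CNF n) {p : ℕ} (d : PathDecomposition (incidenceGraph F))
               (wd : width d ≡ p) where
  open PathDecomposition d
  open EliminationOrder d

  m : ℕ
  m = length F

  clause : Fin m → Clause n
  clause = lookup F

  varV : Fin n → Fin (n + m)
  varV x = x ↑ˡ m

  clauseV : Fin m → Fin (n + m)
  clauseV j = n ↑ʳ j

  rank : Fin n → ℕ
  rank x = order (varV x)

  rank-injective : ∀ {x y} → rank x ≡ rank y → x ≡ y
  rank-injective {x} {y} eq = ↑ˡ-injective m x y (order-injective eq)

  home : Fin n → Fin L
  home x = first (varV x)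

  home-mono : ∀ {x y} → rank x ≤ rank y → toℕ (home x) ≤ toℕ (home y)
  home-mono = order-≤⇒first-≤

  before : Fin n → Fin n → Bool
  before x y = does (rank y <? rank x)

  upto : Fin n → Fin n → Bool
  upto x y = does (rank y ≤? rank x)

  is : Fin n → Fin n → Bool
  is x y = does (y ≟ᶠ x)

  before-self : ∀ x → before x x ≡ false
  before-self x = dec-false (rank x <? rank x) (n≮n (rank x))

  upto-self : ∀ x → upto x x ≡ true
  upto-self x = dec-true (rank x ≤? rank x) ≤-refl

  upto-other⇒before : ∀ {x y} → upto x y ≡ true → y ≢ x → rank y < rank x
  upto-other⇒before {x} {y} up y≢x = ≤∧≢⇒< (does-true (rank y ≤? rank x) up) (y≢x ∘ rank-injective)

  before≡upto : ∀ x y → y ≢ x → before x y ≡ upto x y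
  before≡upto x y y≢x =
    does-⇔ (mk⇔ <⇒≤ (λ y≤x → ≤∧≢⇒< y≤x (y≢x ∘ rank-injective))) (rank y <? rank x) (rank y ≤? rank x)

  before-next : ∀ {x y} → rank x < rank y → (∀ z → rank x < rank z → rank y ≤ rank z) →
                ∀ w → before y w ≡ upto x w
  before-next {x} {y} x<y y-next w = does-⇔ (mk⇔ w<y⇒w≤x (λ w≤x → ≤-<-trans w≤x x<y)) (rank w <? rank y) (rank w ≤? rank x)
    where
      w<y⇒w≤x : rank w < rank y → rank w ≤ rank x
      w<y⇒w≤x w<y = ≮⇒≥ (λ x<w → <⇒≱ w<y (y-next w x<w))

  before-first : ∀ {y} → (∀ z → rank y ≤ rank z) → ∀ w → before y w ≡ false
  before-first {y} y-first w = dec-false (rank w <? rank y) (λ w<y → <⇒≱ w<y (y-first w))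

  -- A state assigns a Boolean to each vertex of the incidence graph; only its
  -- restriction to the current bag is stored in a node.
  State : Set
  State = Fin (n + m) → Bool

  M : ℕ
  M = 2 ^ suc p

  store : Fin n → State → Fin M
  store x = encode (bag (home x)) (bag-size d wd (home x))

  load : Fin n → Fin M → State
  load x = decode (bag (home x)) (bag-size d wd (home x))

  load-store : ∀ x g v → v ∈ₛ bag (home x) → load x (store x g) v ≡ g v
  load-store x g = decode-encode (bag (home x)) (bag-size d wd (home x)) g

  assign : Fin n → State → Bool → Assignment n
  assign x g b y = if is x y then b else g (varV y)

  assign-self : ∀ x g b → assign x g b x ≡ b
  assign-self x g b rewrite dec-true (x ≟ᶠ x) refl = refl

  -- A clause in the current bag adds the literals of x
  -- to its stored status; a clause outside the bag is evaluated afresh on the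
  -- variables read by now, which the bag still knows (`separated-neighbour`).
  readClause : Fin n → State → Bool → Fin m → Bool
  readClause x g b j =
    if does (clauseV j ∈? bag (home x))
    then g (clauseV j) ∨ satBy (is x) (assign x g b) (clause j)
    else satBy (upto x) (assign x g b) (clause j)

  read : Fin n → State → Bool → State
  read x g b v = [ (λ y → upto x y ∧ assign x g b y) , readClause x g b ]′ (splitAt n v)

  read-var : ∀ x g b y → read x g b (varV y) ≡ (upto x y ∧ assign x g b y)
  read-var x g b y = cong [ (λ y → upto x y ∧ assign x g b y) , readClause x g b ]′ (splitAt-↑ˡ n y m)

  read-clause : ∀ x g b j → read x g b (clauseV j) ≡ readClause x g b j
  read-clause x g b j = cong [ (λ y → upto x y ∧ assign x g b y) , readClause x g b ]′ (splitAt-↑ʳ n m j)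

  completes : Fin n → Fin m → Bool
  completes x j = any (is x ∘ proj₁) (clause j) ∧ all (upto x ∘ proj₁) (clause j)

  falsified : Fin n → State → Bool
  falsified x g = any (λ j → completes x j ∧ not (g (clauseV j))) (allFin m)

  -- Internal nodes are pairs (variable, stored state).
  Node : Set
  Node = Fin (n * M) ⊎ Bool

  unpack : Fin (n * M) → Fin n × Fin M
  unpack = remQuot M

  varOf : Fin (n * M) → Fin n
  varOf u = proj₁ (unpack u)

  stateOf : Fin (n * M) → State
  stateOf u = load (varOf u) (proj₂ (unpack u))

  next : ∀ x → Least rank (λ z → rank x < rank z)
  next x = least rank (λ z → rank x < rank z) (λ z → rank x <? rank z)

  firstVar : Least rank (λ _ → ⊤)
  firstVar = least rank (λ _ → ⊤) (λ _ → yes tt)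

  -- Go to the node of the chosen variable with state g; with no variable left
  -- every clause has been checked and the answer is true.
  jump : ∀ {P} → Least rank P → State → Node
  jump (found y _ _) g = inj₁ (combine y (store y g))
  jump (none _)      _ = inj₂ true

  exit : Fin n → Bool → State → Node
  exit x true  g = inj₂ false
  exit x false g = jump (next x) g

  after : Fin (n * M) → Bool → State
  after u b = read (varOf u) (stateOf u) b

  child : Fin (n * M) → Bool → Node
  child u b = exit (varOf u) (falsified (varOf u) (after u b)) (after u b)

  -- An empty clause makes F unsatisfiable; otherwise start at the first variable.
  start : Bool → Node
  start true  = inj₂ false
  start false = jump firstVar (λ _ → false)

  jump-target : ∀ {P} (r : Least rank P) g v → jump r g ≡ inj₁ v → P (varOf v)
  jump-target {P} (found y Py _) g _ refl =
    subst P (sym (cong proj₁ (remQuot-combine y (store y g)))) Py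

  exit-target : ∀ x b g v → exit x b g ≡ inj₁ v → rank x < rank (varOf v)
  exit-target x false g = jump-target (next x) g

  B : OBDD n
  B = record
    { k              = n * M
    ; rank           = rank
    ; rank-injective = rank-injective
    ; root           = start (any null F)
    ; var            = varOf
    ; child          = child
    ; ordered        = λ u b → exit-target (varOf u) (falsified (varOf u) (after u b)) (after u b)
    }

  module Run (a : Assignment n) where

    Live : Fin n → Fin m → Set
    Live x j = ∃[ z ] (OccursIn z (clause j) × rank x ≤ rank z)

    VarsOK : Fin n → State → Set
    VarsOK x g = ∀ y → varV y ∈ₛ bag (home x) → g (varV y) ≡ (before x y ∧ a y)

    ClausesOK : Fin n → State → Set
    ClausesOK x g = ∀ j → clauseV j ∈ₛ bag (home x) → Live x j →
                    g (clauseV j) ≡ satBy (before x) a (clause j)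

    ClosedOK : Fin n → Set
    ClosedOK x = ∀ j → (∀ z → OccursIn z (clause j) → rank z < rank x) → evalClause a (clause j) ≡ true

    Consistent : Fin n → State → Set
    Consistent x g = VarsOK x g × ClausesOK x g × ClosedOK x

    assign-correct : ∀ {x} g → VarsOK x g → ∀ y → upto x y ≡ true →
                     (y ≢ x → varV y ∈ₛ bag (home x)) → assign x g (a x) y ≡ a y
    assign-correct {x} g vars y up in-bag with y ≟ᶠ x
    ... | yes refl = refl
    ... | no  y≢x  = begin
      g (varV y)         ≡⟨ vars y (in-bag y≢x) ⟩
      (before x y ∧ a y) ≡⟨ cong (_∧ a y) (trans (before≡upto x y y≢x) up) ⟩
      a y                ∎
      where open ≡-Reasoning

    read-var-correct : ∀ {x} g → VarsOK x g → ∀ w t → toℕ (home x) ≤ toℕ t → varV w ∈ₛ bag t →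
                       read x g (a x) (varV w) ≡ (upto x w ∧ a w)
    read-var-correct {x} g vars w t home≤t w∈t = trans (read-var x g (a x) w) masked
      where
        masked : (upto x w ∧ assign x g (a x) w) ≡ (upto x w ∧ a w)
        masked with upto x w in up
        ... | false = refl
        ... | true  = assign-correct g vars w up
                        (λ w≢x → earlier-in-first-bag t (upto-other⇒before up w≢x) home≤t w∈t)

    read-clause-correct : ∀ {x} g j → VarsOK x g → ClausesOK x g → Live x j →
                          read x g (a x) (clauseV j) ≡ satBy (upto x) a (clause j)
    read-clause-correct {x} g j vars clauses live@(z , z∈j , x≤z) =
      trans (read-clause x g (a x) j) by-bag
      where
        open ≡-Reasoning
        C = clause j
        h = assign x g (a x)

        extend : ∀ l → ((before x (proj₁ l) ∧ evalLit a l) ∨ (is x (proj₁ l) ∧ evalLit h l))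
                       ≡ (upto x (proj₁ l) ∧ evalLit a l)
        extend (y , pol) with y ≟ᶠ x
        ... | yes refl rewrite before-self x | upto-self x = evalLit-cong h a pol (assign-self x g (a x))
        ... | no  y≢x  = trans (∨-identityʳ _) (cong (_∧ evalLit a (y , pol)) (before≡upto x y y≢x))

        by-bag : readClause x g (a x) j ≡ satBy (upto x) a C
        by-bag with clauseV j ∈? bag (home x)
        ... | yes c∈ = begin
          g (clauseV j) ∨ satBy (is x) h C          ≡⟨ cong (_∨ satBy (is x) h C) (clauses j c∈ live) ⟩
          satBy (before x) a C ∨ satBy (is x) h C   ≡⟨ any-∨ _ _ C ⟩
          any (λ l → (before x (proj₁ l) ∧ evalLit a l) ∨ (is x (proj₁ l) ∧ evalLit h l)) C
                                                    ≡⟨ any-cong _ _ C (λ l _ → extend l) ⟩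
          satBy (upto x) a C                        ∎
        ... | no  c∉ = satBy-cong (upto x) h a C λ y pol y∈C up →
          assign-correct g vars y up λ y≢x →
            separated-neighbour (var-clause z j z∈j) (var-clause y j (pol , y∈C)) x≤z c∉
                                (upto-other⇒before up y≢x)

    occurs⇒live : ∀ x j → any (is x ∘ proj₁) (clause j) ≡ true → Live x j
    occurs⇒live x j has-x with any-true⇒ (is x ∘ proj₁) (clause j) has-x
    ... | (y , pol) , l∈C , y-is-x with does-true (y ≟ᶠ x) y-is-x
    ...   | refl = x , (pol , l∈C) , ≤-refl

    completed-value : ∀ {x} g j → VarsOK x g → ClausesOK x g →
                      any (is x ∘ proj₁) (clause j) ≡ true → all (upto x ∘ proj₁) (clause j) ≡ true →
                      read x g (a x) (clauseV j) ≡ evalClause a (clause j)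
    completed-value {x} g j vars clauses has-x all-read =
      trans (read-clause-correct g j vars clauses (occurs⇒live x j has-x)) (satBy-all (upto x) a (clause j) all-read)

    falsified⇒unsat : ∀ {x} g → VarsOK x g → ClausesOK x g →
                      falsified x (read x g (a x)) ≡ true → evalCNF a F ≡ false
    falsified⇒unsat {x} g vars clauses fails
      with any-true⇒ (λ j → completes x j ∧ not (read x g (a x) (clauseV j))) (allFin m) fails
    ... | j , _ , bad with ∧-true {completes x j} bad
    ...   | compl , unsat with ∧-true {any (is x ∘ proj₁) (clause j)} compl
    ...     | has-x , all-read = all-false⇐ (evalClause a) F (clause j) (∈-lookup j)
                (trans (sym (completed-value g j vars clauses has-x all-read)) (not-true unsat))

    -- If the check at x passes, every clause with all variables read by x is
    -- satisfied: those containing x were checked, the others are closed.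
    completed-satisfied : ∀ {x} g → Consistent x g → falsified x (read x g (a x)) ≡ false →
                          ∀ j → (∀ z → OccursIn z (clause j) → rank z ≤ rank x) →
                          evalClause a (clause j) ≡ true
    completed-satisfied {x} g (vars , clauses , closed) passes j all≤
      with any (is x ∘ proj₁) (clause j) in has-x
    ... | true = trans (sym (completed-value g j vars clauses has-x all-read)) checked
      where
        all-read : all (upto x ∘ proj₁) (clause j) ≡ true
        all-read = all-true⇐ _ (clause j)
                     (λ (z , pol) z∈j → dec-true (rank z ≤? rank x) (all≤ z (pol , z∈j)))
        checked : read x g (a x) (clauseV j) ≡ true
        checked with any-false⇒ _ (allFin m) passes j (∈-allFin j)
        ... | ok rewrite has-x | all-read = not-false ok
    ... | false = closed j λ z (pol , z∈j) → ≤∧≢⇒< (all≤ z (pol , z∈j)) (λ z≡x → x∉ z pol z∈j (rank-injective z≡x))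
      where
        x∉ : ∀ z pol → (z , pol) ∈ clause j → z ≢ x
        x∉ z pol z∈j refl with trans (sym (dec-true (z ≟ᶠ z) refl)) (any-false⇒ _ (clause j) has-x (z , pol) z∈j)
        ... | ()

    consistent-next : ∀ {x y} g → rank x < rank y → (∀ z → rank x < rank z → rank y ≤ rank z) →
                      Consistent x g → falsified x (read x g (a x)) ≡ false →
                      Consistent y (load y (store y (read x g (a x))))
    consistent-next {x} {y} g x<y y-next inv@(vars , clauses , _) passes = vars′ , clauses′ , closed′
      where
        open ≡-Reasoning
        g′ = read x g (a x)

        vars′ : VarsOK y (load y (store y g′))
        vars′ w w∈ = begin
          load y (store y g′) (varV w) ≡⟨ load-store y g′ (varV w) w∈ ⟩
          g′ (varV w)                  ≡⟨ read-var-correct g vars w (home y) (home-mono (<⇒≤ x<y)) w∈ ⟩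
          (upto x w ∧ a w)             ≡⟨ cong (_∧ a w) (sym (before-next x<y y-next w)) ⟩
          (before y w ∧ a w)           ∎

        clauses′ : ClausesOK y (load y (store y g′))
        clauses′ j c∈ (z , z∈j , y≤z) = begin
          load y (store y g′) (clauseV j) ≡⟨ load-store y g′ (clauseV j) c∈ ⟩
          g′ (clauseV j)                  ≡⟨ read-clause-correct g j vars clauses (z , z∈j , ≤-trans (<⇒≤ x<y) y≤z) ⟩
          satBy (upto x) a (clause j)     ≡⟨ satBy-reads-cong a (clause j) (sym ∘ before-next x<y y-next) ⟩
          satBy (before y) a (clause j)   ∎

        closed′ : ClosedOK y
        closed′ j all<y = completed-satisfied g inv passes j
          λ z z∈j → ≮⇒≥ (λ x<z → <⇒≱ (all<y z z∈j) (y-next z x<z))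

    consistent-first : ∀ {y} → (∀ z → rank y ≤ rank z) → any null F ≡ false →
                       Consistent y (load y (store y (λ _ → false)))
    consistent-first {y} y-first no-empty = vars , clauses , closed
      where
        vars : VarsOK y (load y (store y (λ _ → false)))
        vars w w∈ = trans (load-store y _ (varV w) w∈) (sym (cong (_∧ a w) (before-first y-first w)))

        clauses : ClausesOK y (load y (store y (λ _ → false)))
        clauses j c∈ _ = trans (load-store y _ (clauseV j) c∈)
                               (sym (satBy-none (before y) a (clause j) (before-first y-first)))

        closed : ClosedOK y
        closed j all<y with null-false⇒literal (clause j) (any-false⇒ null F no-empty (clause j) (∈-lookup j))
        ... | (z , pol) , z∈j = contradiction (y-first z) (<⇒≱ (all<y z (pol , z∈j)))

    -- Ranks are below K, so K bounds the number of reads still to come.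
    K : ℕ
    K = L * (n + m)

    Enter : ℕ → Fin n × Fin M → Set
    Enter fuel (x , σ) = K ≤ rank x + fuel × Consistent x (load x σ)

    mutual
      reach : ∀ fuel u → Enter fuel (unpack u) → Reaches B a (inj₁ u) (evalCNF a F)
      reach zero       u (bound , _)   =
        contradiction (subst (K ≤_) (+-identityʳ _) bound) (<⇒≱ (order<bound (varV (varOf u))))
      reach (suc fuel) u (bound , inv) =
        step u (evalCNF a F) (exit-reaches fuel (varOf u) (stateOf u) bound inv _ refl)

      exit-reaches : ∀ fuel x g → K ≤ rank x + suc fuel → Consistent x g →
                     ∀ b → falsified x (read x g (a x)) ≡ b →
                     Reaches B a (exit x b (read x g (a x))) (evalCNF a F)
      exit-reaches fuel x g _ (vars , clauses , _) true fails =
        subst (Reaches B a (inj₂ false)) (sym (falsified⇒unsat g vars clauses fails)) (sink false)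
      exit-reaches fuel x g bound inv false passes =
        jump-reaches fuel (next x) (read x g (a x)) all-read enter
        where
          all-read : (∀ z → ¬ rank x < rank z) → evalCNF a F ≡ true
          all-read last = all-lookup⇐ (evalClause a) F
                            (λ j → completed-satisfied g inv passes j (λ z _ → ≮⇒≥ (last z)))

          enter : ∀ y → rank x < rank y → (∀ z → rank x < rank z → rank y ≤ rank z) →
                  Enter fuel (y , store y (read x g (a x)))
          enter y x<y y-next =
            ≤-trans bound (≤-trans (≤-reflexive (+-suc (rank x) fuel)) (+-monoˡ-≤ fuel x<y)) ,
            consistent-next g x<y y-next inv passes

      jump-reaches : ∀ fuel {P} (r : Least rank P) g →
                     ((∀ z → ¬ P z) → evalCNF a F ≡ true) →
                     (∀ y → P y → (∀ z → P z → rank y ≤ rank z) → Enter fuel (y , store y g)) →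
                     Reaches B a (jump r g) (evalCNF a F)
      jump-reaches fuel (none ¬P) g done _ =
        subst (Reaches B a (inj₂ true)) (sym (done ¬P)) (sink true)
      jump-reaches fuel (found y Py y-min) g _ enter =
        reach fuel (combine y (store y g))
              (subst (Enter fuel) (sym (remQuot-combine y (store y g))) (enter y Py y-min))

    root-reaches : ∀ b → any null F ≡ b → Reaches B a (start b) (evalCNF a F)
    root-reaches true has-empty with any-true⇒ null F has-empty
    ... | C , C∈F , empty =
      subst (Reaches B a (inj₂ false)) (sym (all-false⇐ (evalClause a) F C C∈F (null-unsat a C empty))) (sink false)
    root-reaches false no-empty = jump-reaches K firstVar (λ _ → false) no-variables enter
      where
        -- without variables every clause would be empty
        no-variables : (∀ z → ¬ ⊤) → evalCNF a F ≡ true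
        no-variables no-var = all-true⇐ (evalClause a) F λ C C∈F →
          let ((z , _) , _) = null-false⇒literal C (any-false⇒ null F no-empty C C∈F)
          in contradiction tt (no-var z)

        enter : ∀ y → ⊤ → (∀ z → ⊤ → rank y ≤ rank z) → Enter K (y , store y (λ _ → false))
        enter y _ y-first = m≤n+m K (rank y) , consistent-first (λ z → y-first z tt) no-empty

  computes : Computes B F
  computes a = Run.root-reaches a (any null F) refl

-- n · 2^(p+1) internal nodes and two sinks are at most 4 · 2^p · n nodes.
size-bound : ∀ n P → 1 ≤ n → 1 ≤ P → n * (2 * P) + 2 ≤ 4 * P * n
size-bound n P 1≤n 1≤P = begin
  n * (2 * P) + 2           ≤⟨ +-monoʳ-≤ (n * (2 * P)) (*-monoʳ-≤ 2 (*-mono-≤ 1≤P 1≤n)) ⟩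
  n * (2 * P) + 2 * (P * n) ≡⟨ solve 2 (λ n P → n :* (con 2 :* P) :+ con 2 :* (P :* n) := con 4 :* P :* n) refl n P ⟩
  4 * P * n                 ∎
  where
    open ≤-Reasoning
    open +-*-Solver

theorem2 : ∃[ c ] ((n : ℕ) → 1 ≤ n → (F : CNF n) (p : ℕ) →
             IsPathwidth (incidenceGraph F) p →
             ∃[ B ] (Computes {n} B F × size B ≤ c * 2 ^ p * n))
theorem2 = 4 , λ n 1≤n F p ((d , width≡p) , _) →
  Compile.B F d width≡p , Compile.computes F d width≡p , size-bound n (2 ^ p) 1≤n (m^n>0 2 p)
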